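{- Let $G$ be a connected simple graph with at least one edge. Then its stellated graph $\mathrm{st}(G)$ has a perfect matching, and $\mathrm{st}(G)$ has a unique perfect matching if and only if $G$ is a tree.
   Context: The stellated graph $\mathrm{st}(G)$ of a graph $G$ is the line graph of the subdivision of $G$, where the subdivision is obtained from $G$ by subdividing every edge exactly once (inserting one new vertex into each edge). Equivalently, $\mathrm{st}(G)$ is obtained by replacing each vertex $v$ of $G$ by a clique on $d(v)$ vertices, one for each edge incident with $v$, and joining, for each edge $uv$ of $G$, the clique vertex of $u$ corresponding to $uv$ with the clique vertex of $v$ corresponding to $uv$. -}

module Defs where

open import Data.Nat using (ℕ; _≤_)
open import Data.Bool using (Bool; true; false; _∧_; _∨_; not)
open import Data.Fin using (Fin)
open import Data.Fin.Properties using (_≟_)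
open import Data.List using (List; []; _∷_; length)
open import Data.List.Relation.Unary.Unique.Propositional using (Unique)
open import Data.Product using (Σ; ∃; _×_; _,_; proj₁; proj₂)
open import Relation.Nullary using (¬_; does)
open import Relation.Binary.PropositionalEquality using (_≡_)

record SimpleGraph (n : ℕ) : Set where
  field
    Adj        : Fin n → Fin n → Bool
    adj-sym    : ∀ u v → Adj u v ≡ Adj v u
    adj-irrefl : ∀ u → Adj u u ≡ false
open SimpleGraph public

HasEdge : ∀ {n} → SimpleGraph n → Set
HasEdge G = Σ (Fin _) λ u → Σ (Fin _) λ v → Adj G u v ≡ true

data Walk {n} (G : SimpleGraph n) : Fin n → Fin n → Set where
  nil  : ∀ {u} → Walk G u u
  cons : ∀ {u v w} → Adj G u v ≡ true → Walk G v w → Walk G u w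

support : ∀ {n} {G : SimpleGraph n} {u v} → Walk G u v → List (Fin n)
support {u = u} nil = u ∷ []
support {u = u} (cons _ p) = u ∷ support p

walkLength : ∀ {n} {G : SimpleGraph n} {u v} → Walk G u v → ℕ
walkLength nil = 0
walkLength (cons _ p) = ℕ.suc (walkLength p)

Connected : ∀ {n} → SimpleGraph n → Set
Connected {n} G = ∀ (u v : Fin n) → Walk G u v

-- A cycle: a path u = v₀ … v_k = v with pairwise distinct vertices,
-- k ≥ 2 edges, closed up by the edge v u (so ≥ 3 distinct vertices).
Cycle : ∀ {n} → SimpleGraph n → Set
Cycle {n} G =
  Σ (Fin n) λ u → Σ (Fin n) λ v → Σ (Walk G u v) λ p →
    Unique (support p) × (2 ≤ walkLength p) × (Adj G v u ≡ true)

IsTree : ∀ {n} → SimpleGraph n → Set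
IsTree G = Connected G × ¬ Cycle G

-- Stellated graph st(G) = L(S(G)).
-- Vertices of S(G)'s edge set: pairs (vertex u, incident edge uv),
-- i.e. darts (u , v) with u ~ v.  (u,v) is the vertex of the clique
-- for u corresponding to the edge uv.

Dart : ∀ {n} → SimpleGraph n → Set
Dart {n} G = Σ (Fin n) λ u → Σ (Fin n) λ v → Adj G u v ≡ true

-- adjacency in st(G): same clique (same u, different edge) or the
-- two clique vertices of one edge uv.
stAdj : ∀ {n} (G : SimpleGraph n) → Dart G → Dart G → Bool
stAdj G (u , v , _) (u' , v' , _) =
  (does (u ≟ u') ∧ not (does (v ≟ v'))) ∨ (does (u ≟ v') ∧ does (v ≟ u'))

record PerfectMatching (V : Set) (A : V → V → Bool) : Set where
  field
    M         : V → V → Bool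
    M⊆A       : ∀ v w → M v w ≡ true → A v w ≡ true
    M-sym     : ∀ v w → M v w ≡ M w v
    exactlyOne : ∀ v → Σ V λ w → (M v w ≡ true) × (∀ w' → M v w' ≡ true → w' ≡ w)
open PerfectMatching public

HasPerfectMatching : (V : Set) → (V → V → Bool) → Set
HasPerfectMatching V A = PerfectMatching V A

HasUniquePerfectMatching : (V : Set) → (V → V → Bool) → Set
HasUniquePerfectMatching V A =
  PerfectMatching V A ×
  (∀ (P Q : PerfectMatching V A) → ∀ v w → M P v w ≡ M Q v w)

-- The edges of st(G) joining the two clique vertices of an edge of G form a
-- perfect matching R.  Take any perfect matching P and a dart d = (a , b) that P
-- matches inside a clique.  Then P also matches the reversed dart (b , a)
-- inside the clique of b, to some (b , c) with c ≠ a, and (b , c) is again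
-- matched inside a clique.  Iterating gives a non-backtracking walk in G, which
-- in a finite forest must close up into a cycle; so for an acyclic G every
-- perfect matching is R.  Conversely, along a cycle x₀ … x_k of G one may instead
-- match, in the clique of every xᵢ, its two cycle vertices with each other, and
-- keep R elsewhere: a second perfect matching.
module Submission where

open import Defs
open import Axiom.UniquenessOfIdentityProofs using (module Decidable⇒UIP)
open import Data.Bool using (Bool; true)
import Data.Bool.Properties as Bool
open import Data.Empty using (⊥-elim)
open import Data.Fin using (Fin; toℕ)
open import Data.Fin.Properties using (_≟_; pigeonhole; toℕ-injective; toℕ≤pred[n])
import Data.Fin.Properties as Fin
open import Data.List.Membership.Propositional using (_∈_)
open import Data.List.Relation.Unary.All using (All; []; _∷_)
import Data.List.Relation.Unary.All as All
open import Data.List.Relation.Unary.All.Properties using (¬Any⇒All¬)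
open import Data.List.Relation.Unary.AllPairs using ([]; _∷_)
open import Data.List.Relation.Unary.Any using (here; there)
open import Data.List.Relation.Unary.Unique.Propositional using (Unique)
open import Data.Nat using (ℕ; zero; suc; _≤_; _<_; z≤n; s≤s; _+_)
import Data.Nat as ℕ
open import Data.Nat.Properties
  using (≤-refl; <⇒≤; <⇒≢; <⇒≱; ≰⇒>; ≤∧≢⇒<; n<1+n; m<n⇒m<1+n; m≤m+n; +-suc)
open import Data.Product using (Σ; _×_; _,_; proj₁; proj₂)
open import Data.Product.Properties using (≡-dec)
open import Data.Sum using (_⊎_; inj₁; inj₂)
open import Function using (_∘_; flip)
open import Function.Bundles using (_⇔_; mk⇔)
open import Relation.Binary.Definitions using (DecidableEquality)
open import Relation.Binary.PropositionalEquality
open import Relation.Nullary using (¬_; Dec; does; yes; no; contradiction)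
open import Relation.Nullary.Decidable using (dec-true; dec-false; decidable-stable; _×-dec_; _⊎-dec_)
open import Relation.Unary using (Decidable)

module _ {V : Set} {A : V → V → Bool} (P : PerfectMatching V A) where

  partner : V → V
  partner v = proj₁ (exactlyOne P v)

  partner-matched : ∀ v → M P v (partner v) ≡ true
  partner-matched v = proj₁ (proj₂ (exactlyOne P v))

  matched⇒≡partner : ∀ {v w} → M P v w ≡ true → w ≡ partner v
  matched⇒≡partner {v} {w} = proj₂ (proj₂ (exactlyOne P v)) w

  ≡partner⇒matched : ∀ {v w} → w ≡ partner v → M P v w ≡ true
  ≡partner⇒matched refl = partner-matched _

  partner-involutive : ∀ v → partner (partner v) ≡ v
  partner-involutive v = sym (matched⇒≡partner (trans (M-sym P _ _) (partner-matched v)))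

  partner-adjacent : ∀ v → A v (partner v) ≡ true
  partner-adjacent v = M⊆A P v _ (partner-matched v)

module _ {V : Set} {A : V → V → Bool} (P Q : PerfectMatching V A) where

  partner-≗⇒M-≗ : partner P ≗ partner Q → ∀ v → M P v ≗ M Q v
  partner-≗⇒M-≗ same v w = Bool.⇔→≡ (mk⇔
    (λ m → ≡partner⇒matched Q (trans (matched⇒≡partner P m) (same v)))
    (λ m → ≡partner⇒matched P (trans (matched⇒≡partner Q m) (sym (same v)))))

  M-≗⇒partner-≗ : (∀ v → M P v ≗ M Q v) → partner P ≗ partner Q
  M-≗⇒partner-≗ same v = matched⇒≡partner Q (trans (sym (same v _)) (partner-matched P v))

module _ {V : Set} (_≟V_ : DecidableEquality V) {A : V → V → Bool} where

  involution⇒perfectMatching : (σ : V → V) → (∀ v → σ (σ v) ≡ v) → (∀ v → A v (σ v) ≡ true) →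
                               PerfectMatching V A
  involution⇒perfectMatching σ σ-involutive σ-adjacent = record
    { M          = λ v w → does (w ≟V σ v)
    ; M⊆A        = M⊆A′
    ; M-sym      = M-sym′
    ; exactlyOne = λ v → σ v , dec-true (σ v ≟V σ v) refl , λ w → matched⇒≡σ
    }
    where
    matched⇒≡σ : ∀ {v w} → does (w ≟V σ v) ≡ true → w ≡ σ v
    matched⇒≡σ {v} {w} m with w ≟V σ v
    ... | yes w≡σv = w≡σv

    M⊆A′ : ∀ v w → does (w ≟V σ v) ≡ true → A v w ≡ true
    M⊆A′ v w m rewrite matched⇒≡σ {v} {w} m = σ-adjacent v

    ≡σ-sym : ∀ {v w} → w ≡ σ v → v ≡ σ w
    ≡σ-sym {v} refl = sym (σ-involutive v)

    M-sym′ : ∀ v w → does (w ≟V σ v) ≡ does (v ≟V σ w)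
    M-sym′ v w with w ≟V σ v | v ≟V σ w
    ... | yes _    | yes _    = refl
    ... | no _     | no _     = refl
    ... | yes w≡σv | no v≢σw  = contradiction (≡σ-sym w≡σv) v≢σw
    ... | no w≢σv  | yes v≡σw = contradiction (≡σ-sym v≡σw) w≢σv

-- Successor and predecessor on ℤ/(k+1), with representatives 0 … k.

cycSuc : ℕ → ℕ → ℕ
cycSuc k i with i ℕ.≟ k
... | yes _ = 0
... | no _  = suc i

cycPred : ℕ → ℕ → ℕ
cycPred k zero    = k
cycPred k (suc i) = i

cycSuc-≤ : ∀ {k i} → i ≤ k → cycSuc k i ≤ k
cycSuc-≤ {k} {i} i≤k with i ℕ.≟ k
... | yes _   = z≤n
... | no i≢k  = ≤∧≢⇒< i≤k i≢k

cycPred-≤ : ∀ {k i} → i ≤ k → cycPred k i ≤ k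
cycPred-≤ {i = zero}  _   = ≤-refl
cycPred-≤ {i = suc i} i<k = <⇒≤ i<k

cycPred-cycSuc : ∀ k i → cycPred k (cycSuc k i) ≡ i
cycPred-cycSuc k i with i ℕ.≟ k
... | yes i≡k = sym i≡k
... | no _    = refl

cycSuc-cycPred : ∀ {k i} → i ≤ k → cycSuc k (cycPred k i) ≡ i
cycSuc-cycPred {k} {zero} _ with k ℕ.≟ k
... | yes _   = refl
... | no k≢k  = contradiction refl k≢k
cycSuc-cycPred {k} {suc i} i<k with i ℕ.≟ k
... | yes refl = contradiction i<k (<⇒≱ (n<1+n i))
... | no _     = refl

cycSuc≢cycPred : ∀ {k i} → 2 ≤ k → cycSuc k i ≢ cycPred k i
cycSuc≢cycPred {suc zero} (s≤s ())
cycSuc≢cycPred {suc (suc k)} {zero} _ with zero ℕ.≟ suc (suc k)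
... | no _ = λ ()
cycSuc≢cycPred {suc (suc k)} {suc i} _ with suc i ℕ.≟ suc (suc k)
... | yes refl = λ ()
... | no _     = <⇒≢ (m<n⇒m<1+n (n<1+n i)) ∘ sym

module _ {n : ℕ} {G : SimpleGraph n} where

  vertexAt : ∀ {u v} → Walk G u v → ℕ → Fin n
  vertexAt {v = v} nil        _       = v
  vertexAt {u = u} (cons _ p) zero    = u
  vertexAt         (cons _ p) (suc i) = vertexAt p i

  vertexAt-zero : ∀ {u v} (p : Walk G u v) → vertexAt p 0 ≡ u
  vertexAt-zero nil        = refl
  vertexAt-zero (cons _ _) = refl

  vertexAt-walkLength : ∀ {u v} (p : Walk G u v) → vertexAt p (walkLength p) ≡ v
  vertexAt-walkLength nil        = refl
  vertexAt-walkLength (cons _ p) = vertexAt-walkLength p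

  vertexAt-adjacent : ∀ {u v} (p : Walk G u v) {i} → i < walkLength p →
                      Adj G (vertexAt p i) (vertexAt p (suc i)) ≡ true
  vertexAt-adjacent (cons e p) {zero}  _         =
    subst (λ x → Adj G _ x ≡ true) (sym (vertexAt-zero p)) e
  vertexAt-adjacent (cons _ p) {suc i} (s≤s i<ℓ) = vertexAt-adjacent p i<ℓ

  vertexAt-∈ : ∀ {u v} (p : Walk G u v) {i} → i ≤ walkLength p → vertexAt p i ∈ support p
  vertexAt-∈ nil                z≤n       = here refl
  vertexAt-∈ (cons _ _) {zero}  _         = here refl
  vertexAt-∈ (cons _ p) {suc i} (s≤s i≤ℓ) = there (vertexAt-∈ p i≤ℓ)

  vertexAt-injective : ∀ {u v} (p : Walk G u v) → Unique (support p) →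
                       ∀ {i j} → i ≤ walkLength p → j ≤ walkLength p →
                       vertexAt p i ≡ vertexAt p j → i ≡ j
  vertexAt-injective nil        _           z≤n z≤n _ = refl
  vertexAt-injective (cons _ p) _           {zero}  {zero}  _ _ _ = refl
  vertexAt-injective (cons _ p) (u∉ ∷ _)    {zero}  {suc j} _ (s≤s j≤ℓ) eq =
    ⊥-elim (All.lookup u∉ (vertexAt-∈ p j≤ℓ) eq)
  vertexAt-injective (cons _ p) (u∉ ∷ _)    {suc i} {zero}  (s≤s i≤ℓ) _ eq =
    ⊥-elim (All.lookup u∉ (vertexAt-∈ p i≤ℓ) (sym eq))
  vertexAt-injective (cons _ p) (_ ∷ uniq) {suc i} {suc j} (s≤s i≤ℓ) (s≤s j≤ℓ) eq =
    cong suc (vertexAt-injective p uniq i≤ℓ j≤ℓ eq)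

  walkLength<n : ∀ {u v} (p : Walk G u v) → Unique (support p) → walkLength p < n
  walkLength<n p uniq = ≰⇒> λ n≤ℓ →
    let (i , j , i<j , same) = pigeonhole (s≤s n≤ℓ) (λ i → vertexAt p (toℕ i))
    in Fin.<-irrefl (toℕ-injective (vertexAt-injective p uniq (toℕ≤pred[n] i) (toℕ≤pred[n] j) same)) i<j

  position : ∀ {u v} → Walk G u v → Fin n → ℕ
  position         nil        _ = 0
  position {u = u} (cons _ p) x with x ≟ u
  ... | yes _ = 0
  ... | no _  = suc (position p x)

  position-≤ : ∀ {u v} (p : Walk G u v) x → position p x ≤ walkLength p
  position-≤         nil        _ = z≤n
  position-≤ {u = u} (cons _ p) x with x ≟ u
  ... | yes _ = z≤n
  ... | no _  = s≤s (position-≤ p x)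

  vertexAt-position : ∀ {u v} (p : Walk G u v) {x} → x ∈ support p → vertexAt p (position p x) ≡ x
  vertexAt-position         nil        (here refl) = refl
  vertexAt-position {u = u} (cons _ p) {x} x∈ with x ≟ u | x∈
  ... | yes x≡u | _         = sym x≡u
  ... | no x≢u  | here x≡u  = contradiction x≡u x≢u
  ... | no _    | there x∈p = vertexAt-position p x∈p

  position-vertexAt : ∀ {u v} (p : Walk G u v) → Unique (support p) →
                      ∀ {i} → i ≤ walkLength p → position p (vertexAt p i) ≡ i
  position-vertexAt p uniq i≤ℓ =
    vertexAt-injective p uniq (position-≤ p _) i≤ℓ (vertexAt-position p (vertexAt-∈ p i≤ℓ))

  closedWalk-adjacent : ∀ {u v} (p : Walk G u v) → Adj G v u ≡ true →
                        ∀ {i} → i ≤ walkLength p →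
                        Adj G (vertexAt p i) (vertexAt p (cycSuc (walkLength p) i)) ≡ true
  closedWalk-adjacent p closing {i} i≤ℓ with i ℕ.≟ walkLength p
  ... | yes refl = subst₂ (λ x y → Adj G x y ≡ true)
                          (sym (vertexAt-walkLength p)) (sym (vertexAt-zero p)) closing
  ... | no i≢ℓ   = vertexAt-adjacent p (≤∧≢⇒< i≤ℓ i≢ℓ)

  prefix : ∀ {u v x} (p : Walk G u v) → x ∈ support p → Walk G u x
  prefix nil        (here refl) = nil
  prefix (cons _ _) (here refl) = nil
  prefix (cons e p) (there x∈)  = cons e (prefix p x∈)

  prefix-All : ∀ {Q : Fin n → Set} {u v x} (p : Walk G u v) (x∈ : x ∈ support p) →
               All Q (support p) → All Q (support (prefix p x∈))
  prefix-All nil        (here refl) (qu ∷ _)  = qu ∷ []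
  prefix-All (cons _ _) (here refl) (qu ∷ _)  = qu ∷ []
  prefix-All (cons _ p) (there x∈)  (qu ∷ qs) = qu ∷ prefix-All p x∈ qs

  prefix-unique : ∀ {u v x} (p : Walk G u v) (x∈ : x ∈ support p) →
                  Unique (support p) → Unique (support (prefix p x∈))
  prefix-unique nil        (here refl) _            = [] ∷ []
  prefix-unique (cons _ _) (here refl) _            = [] ∷ []
  prefix-unique (cons _ p) (there x∈)  (u∉ ∷ uniq) = prefix-All p x∈ u∉ ∷ prefix-unique p x∈ uniq

  prefix-long : ∀ {u v x} (p : Walk G u v) (x∈ : x ∈ support p) →
                x ≢ vertexAt p 0 → x ≢ vertexAt p 1 → 2 ≤ walkLength (prefix p x∈)
  prefix-long nil                 (here refl)         x≢₀ _   = contradiction refl x≢₀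
  prefix-long (cons _ _)          (here refl)         x≢₀ _   = contradiction refl x≢₀
  prefix-long (cons _ nil)        (there (here refl)) _   x≢₁ = contradiction refl x≢₁
  prefix-long (cons _ (cons _ _)) (there (here refl)) _   x≢₁ = contradiction refl x≢₁
  prefix-long (cons _ (cons _ _)) (there (there _))   _   _   = s≤s (s≤s z≤n)

module _ {n : ℕ} (G : SimpleGraph n) where

  open import Data.List.Membership.DecPropositional (_≟_ {n}) using (_∈?_)

  adjacent-irrelevant : ∀ {u v} (e e′ : Adj G u v ≡ true) → e ≡ e′
  adjacent-irrelevant = Decidable⇒UIP.≡-irrelevant Bool._≟_

  adjacent-sym : ∀ {u v} → Adj G u v ≡ true → Adj G v u ≡ true
  adjacent-sym {u} {v} e = trans (adj-sym G v u) e

  adjacent⇒≢ : ∀ {u v} → Adj G u v ≡ true → u ≢ v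
  adjacent⇒≢ {u} e refl = contradiction (trans (sym e) (adj-irrefl G u)) λ ()

  origin target : Dart G → Fin n
  origin = proj₁
  target d = proj₁ (proj₂ d)

  dart-≡ : ∀ {u v u′ v′} {e : Adj G u v ≡ true} {e′ : Adj G u′ v′ ≡ true} →
           u ≡ u′ → v ≡ v′ → _≡_ {A = Dart G} (u , v , e) (u′ , v′ , e′)
  dart-≡ refl refl = cong (λ e → _ , _ , e) (adjacent-irrelevant _ _)

  _≟ᵈ_ : DecidableEquality (Dart G)
  _≟ᵈ_ = ≡-dec _≟_ (≡-dec _≟_ λ e e′ → yes (adjacent-irrelevant e e′))

  origin≢target : ∀ d → origin d ≢ target d
  origin≢target (_ , _ , e) = adjacent⇒≢ e

  reverse : Dart G → Dart G
  reverse (u , v , e) = v , u , adjacent-sym e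

  reverse-involutive : ∀ d → reverse (reverse d) ≡ d
  reverse-involutive _ = dart-≡ refl refl

  stAdj-reverse : ∀ d → stAdj G d (reverse d) ≡ true
  stAdj-reverse (u , v , _) rewrite dec-true (u ≟ u) refl | dec-true (v ≟ v) refl = Bool.∨-zeroʳ _

  stAdj-sameOrigin : ∀ {u v v′} (e : Adj G u v ≡ true) (e′ : Adj G u v′ ≡ true) →
                     v ≢ v′ → stAdj G (u , v , e) (u , v′ , e′) ≡ true
  stAdj-sameOrigin {u} {v} {v′} _ _ v≢v′ rewrite dec-true (u ≟ u) refl | dec-false (v ≟ v′) v≢v′ = refl

  stAdj-cases : ∀ d d′ → stAdj G d d′ ≡ true →
                (origin d ≡ origin d′ × target d ≢ target d′) ⊎ d′ ≡ reverse d
  stAdj-cases (u , v , _) (u′ , v′ , _) adj with u ≟ u′ | v ≟ v′ | u ≟ v′ | v ≟ u′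
  ... | _        | _        | yes u≡v′ | yes v≡u′ = inj₂ (dart-≡ (sym v≡u′) (sym u≡v′))
  ... | yes u≡u′ | no v≢v′  | _        | _        = inj₁ (u≡u′ , v≢v′)
  stAdj-cases _ _ () | no _  | _     | yes _ | no _
  stAdj-cases _ _ () | no _  | _     | no _  | _
  stAdj-cases _ _ () | yes _ | yes _ | yes _ | no _
  stAdj-cases _ _ () | yes _ | yes _ | no _  | _

  reversalMatching : PerfectMatching (Dart G) (stAdj G)
  reversalMatching = involution⇒perfectMatching _≟ᵈ_ reverse reverse-involutive stAdj-reverse

  NonBacktracking : (Dart G → Set) → Set
  NonBacktracking B = ∀ d → B d → Σ (Dart G) λ d′ → origin d′ ≡ target d × target d′ ≢ origin d × B d′

  -- The walk is grown backwards, so its newest vertex is always its first one;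
  -- the fuel bounds how often it can grow before it has more than n vertices.
  acyclic⇒nonBacktracking-empty : ¬ Cycle G → ∀ {B} → NonBacktracking B → ∀ d → ¬ B d
  acyclic⇒nonBacktracking-empty acyclic {B} continue (a , b , e) =
    extend n e nil ((adjacent⇒≢ e ∘ sym ∷ []) ∷ [] ∷ []) (m≤m+n n 1)
    where
    prepend : ∀ {a b w} → Adj G a b ≡ true → Walk G a w → Walk G b w
    prepend e = cons (adjacent-sym e)

    extend : ∀ fuel {a b w} (e : Adj G a b ≡ true) (q : Walk G a w) →
             Unique (support (prepend e q)) → n ≤ fuel + walkLength (prepend e q) → ¬ B (a , b , e)
    extend zero e q uniq n≤ _ = <⇒≱ (walkLength<n (prepend e q) uniq) n≤
    extend (suc fuel) {a} {b} e q uniq n≤ bad with continue (a , b , e) bad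
    ... | (_ , c , e′) , refl , c≢a , bad′ with c ∈? support (prepend e q)
    ...   | yes c∈ = acyclic (b , c , prefix (prepend e q) c∈ , prefix-unique (prepend e q) c∈ uniq ,
                              prefix-long (prepend e q) c∈ (adjacent⇒≢ e′ ∘ sym) (c≢a ∘ flip trans (vertexAt-zero q)) ,
                              adjacent-sym e′)
    ...   | no c∉  = extend fuel e′ (prepend e q) (¬Any⇒All¬ _ c∉ ∷ uniq)
                            (subst (n ≤_) (sym (+-suc fuel _)) n≤) bad′

  module _ (P : PerfectMatching (Dart G) (stAdj G)) where

    MatchedInClique : Dart G → Set
    MatchedInClique d = partner P d ≢ reverse d

    reverse-matchedInClique : ∀ d → MatchedInClique d → MatchedInClique (reverse d)
    reverse-matchedInClique d inClique eq = inClique (begin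
      partner P d                          ≡⟨ cong (partner P) (trans (sym (reverse-involutive d)) (sym eq)) ⟩
      partner P (partner P (reverse d))    ≡⟨ partner-involutive P (reverse d) ⟩
      reverse d                            ∎)
      where open ≡-Reasoning

    matchedInClique-nonBacktracking : NonBacktracking MatchedInClique
    matchedInClique-nonBacktracking d inClique
      with stAdj-cases (reverse d) (partner P (reverse d)) (partner-adjacent P (reverse d))
    ... | inj₂ eq             = contradiction eq (reverse-matchedInClique d inClique)
    ... | inj₁ (same , differ) = d′ , sym same , differ ∘ sym , d′-inClique
      where
      d′ = partner P (reverse d)
      d′-inClique : MatchedInClique d′
      d′-inClique eq = origin≢target d′
        (trans (sym same) (cong origin (trans (sym (partner-involutive P (reverse d))) eq)))

  acyclic⇒partner≡reverse : ¬ Cycle G → ∀ P d → partner P d ≡ reverse d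
  acyclic⇒partner≡reverse acyclic P d = decidable-stable (partner P d ≟ᵈ reverse d)
    (acyclic⇒nonBacktracking-empty acyclic (matchedInClique-nonBacktracking P) d)

  acyclic⇒uniquePerfectMatching : ¬ Cycle G → HasUniquePerfectMatching (Dart G) (stAdj G)
  acyclic⇒uniquePerfectMatching acyclic = reversalMatching , λ P Q →
    partner-≗⇒M-≗ P Q λ d → trans (acyclic⇒partner≡reverse acyclic P d)
                                   (sym (acyclic⇒partner≡reverse acyclic Q d))

  -- A nonempty union of vertex-disjoint oriented cycles of G; x ~ next x and
  -- next x ≢ prev x rule out cycles of length 1 and 2.
  record OrientedCycles : Set₁ where
    field
      OnCycle       : Fin n → Set
      onCycle?      : Decidable OnCycle
      next prev     : Fin n → Fin n
      next-on       : ∀ {x} → OnCycle x → OnCycle (next x)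
      prev-on       : ∀ {x} → OnCycle x → OnCycle (prev x)
      prev-next     : ∀ {x} → OnCycle x → prev (next x) ≡ x
      next-prev     : ∀ {x} → OnCycle x → next (prev x) ≡ x
      next-adjacent : ∀ {x} → OnCycle x → Adj G x (next x) ≡ true
      next≢prev     : ∀ {x} → OnCycle x → next x ≢ prev x
      start         : Fin n
      start-on      : OnCycle start

  cycle⇒orientedCycles : Cycle G → OrientedCycles
  cycle⇒orientedCycles (_ , _ , p , uniq , 2≤ℓ , closing) = record
    { OnCycle       = _∈ support p
    ; onCycle?      = _∈? support p
    ; next          = next
    ; prev          = prev
    ; next-on       = λ _ → vertexAt-∈ p (cycSuc-≤ (position-≤ p _))
    ; prev-on       = λ _ → vertexAt-∈ p (cycPred-≤ (position-≤ p _))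
    ; prev-next     = index-inverse⇒vertex-inverse cycPred cycSuc cycSuc-≤ (λ _ → cycPred-cycSuc _ _)
    ; next-prev     = index-inverse⇒vertex-inverse cycSuc cycPred cycPred-≤ cycSuc-cycPred
    ; next-adjacent = λ {x} x∈ → subst (λ y → Adj G y (next x) ≡ true) (vertexAt-position p x∈)
                                       (closedWalk-adjacent p closing (position-≤ p x))
    ; next≢prev     = λ {x} _ → cycSuc≢cycPred 2≤ℓ ∘
                        vertexAt-injective p uniq (cycSuc-≤ (position-≤ p x)) (cycPred-≤ (position-≤ p x))
    ; start         = vertexAt p 0
    ; start-on      = vertexAt-∈ p z≤n
    }
    where
    ℓ = walkLength p

    next prev : Fin n → Fin n
    next x = vertexAt p (cycSuc ℓ (position p x))
    prev x = vertexAt p (cycPred ℓ (position p x))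

    index-inverse⇒vertex-inverse : (f g : ℕ → ℕ → ℕ) →
      (∀ {i} → i ≤ ℓ → g ℓ i ≤ ℓ) → (∀ {i} → i ≤ ℓ → f ℓ (g ℓ i) ≡ i) →
      ∀ {x} → x ∈ support p → vertexAt p (f ℓ (position p (vertexAt p (g ℓ (position p x))))) ≡ x
    index-inverse⇒vertex-inverse f g g-≤ f∘g {x} x∈ = begin
      vertexAt p (f ℓ (position p (vertexAt p (g ℓ i))))  ≡⟨ cong (vertexAt p ∘ f ℓ) (position-vertexAt p uniq (g-≤ i≤ℓ)) ⟩
      vertexAt p (f ℓ (g ℓ i))                             ≡⟨ cong (vertexAt p) (f∘g i≤ℓ) ⟩
      vertexAt p i                                         ≡⟨ vertexAt-position p x∈ ⟩
      x                                                    ∎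
      where
      open ≡-Reasoning
      i = position p x
      i≤ℓ = position-≤ p x

  module _ (C : OrientedCycles) where
    open OrientedCycles C

    prev-adjacent : ∀ {x} → OnCycle x → Adj G x (prev x) ≡ true
    prev-adjacent x-on = adjacent-sym
      (subst (λ y → Adj G _ y ≡ true) (next-prev x-on) (next-adjacent (prev-on x-on)))

    CycleDart : Dart G → Set
    CycleDart (x , y , _) = OnCycle x × (y ≡ next x ⊎ y ≡ prev x)

    cycleDart? : Decidable CycleDart
    cycleDart? (x , y , _) = onCycle? x ×-dec (y ≟ next x ⊎-dec y ≟ prev x)

    cycleDart-reverse : ∀ d → CycleDart (reverse d) → CycleDart d
    cycleDart-reverse (x , y , _) (y-on , inj₁ refl) = next-on y-on , inj₂ (sym (prev-next y-on))
    cycleDart-reverse (x , y , _) (y-on , inj₂ refl) = prev-on y-on , inj₁ (sym (next-prev y-on))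

    swap : Dart G → Dart G
    swap d@(x , _ , _) with cycleDart? d
    ... | yes (x-on , inj₁ _) = x , prev x , prev-adjacent x-on
    ... | yes (x-on , inj₂ _) = x , next x , next-adjacent x-on
    ... | no _                = reverse d

    swap-next : ∀ {x y e} (x-on : OnCycle x) → y ≡ next x → swap (x , y , e) ≡ (x , prev x , prev-adjacent x-on)
    swap-next {x} {y} {e} x-on y≡next with cycleDart? (x , y , e)
    ... | yes (_ , inj₁ _)      = dart-≡ refl refl
    ... | yes (_ , inj₂ y≡prev) = contradiction (trans (sym y≡next) y≡prev) (next≢prev x-on)
    ... | no ¬cycle             = contradiction (x-on , inj₁ y≡next) ¬cycle

    swap-prev : ∀ {x y e} (x-on : OnCycle x) → y ≡ prev x → swap (x , y , e) ≡ (x , next x , next-adjacent x-on)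
    swap-prev {x} {y} {e} x-on y≡prev with cycleDart? (x , y , e)
    ... | yes (_ , inj₁ y≡next) = contradiction (trans (sym y≡next) y≡prev) (next≢prev x-on)
    ... | yes (_ , inj₂ _)      = dart-≡ refl refl
    ... | no ¬cycle             = contradiction (x-on , inj₂ y≡prev) ¬cycle

    swap-off : ∀ d → ¬ CycleDart d → swap d ≡ reverse d
    swap-off d ¬cycle with cycleDart? d
    ... | yes cycle = contradiction cycle ¬cycle
    ... | no _      = refl

    swap-involutive : ∀ d → swap (swap d) ≡ d
    swap-involutive d@(x , y , e) = by-cases (cycleDart? d)
      where
      open ≡-Reasoning
      by-cases : Dec (CycleDart d) → swap (swap d) ≡ d
      by-cases (yes (x-on , inj₁ y≡next)) = begin
        swap (swap d)                          ≡⟨ cong swap (swap-next x-on y≡next) ⟩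
        swap (x , prev x , prev-adjacent x-on) ≡⟨ swap-prev x-on refl ⟩
        (x , next x , next-adjacent x-on)      ≡⟨ dart-≡ refl (sym y≡next) ⟩
        d                                      ∎
      by-cases (yes (x-on , inj₂ y≡prev)) = begin
        swap (swap d)                          ≡⟨ cong swap (swap-prev x-on y≡prev) ⟩
        swap (x , next x , next-adjacent x-on) ≡⟨ swap-next x-on refl ⟩
        (x , prev x , prev-adjacent x-on)      ≡⟨ dart-≡ refl (sym y≡prev) ⟩
        d                                      ∎
      by-cases (no ¬cycle) = begin
        swap (swap d)       ≡⟨ cong swap (swap-off d ¬cycle) ⟩
        swap (reverse d)    ≡⟨ swap-off (reverse d) (¬cycle ∘ cycleDart-reverse d) ⟩
        reverse (reverse d) ≡⟨ reverse-involutive d ⟩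
        d                   ∎

    stAdj-swap : ∀ d → stAdj G d (swap d) ≡ true
    stAdj-swap d@(x , y , e) = by-cases (cycleDart? d)
      where
      by-cases : Dec (CycleDart d) → stAdj G d (swap d) ≡ true
      by-cases (yes (x-on , inj₁ y≡next)) = subst (λ d′ → stAdj G d d′ ≡ true) (sym (swap-next x-on y≡next))
        (stAdj-sameOrigin e (prev-adjacent x-on) λ y≡prev → next≢prev x-on (trans (sym y≡next) y≡prev))
      by-cases (yes (x-on , inj₂ y≡prev)) = subst (λ d′ → stAdj G d d′ ≡ true) (sym (swap-prev x-on y≡prev))
        (stAdj-sameOrigin e (next-adjacent x-on) λ y≡next → next≢prev x-on (trans (sym y≡next) y≡prev))
      by-cases (no ¬cycle) = subst (λ d′ → stAdj G d d′ ≡ true) (sym (swap-off d ¬cycle)) (stAdj-reverse d)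

    swapMatching : PerfectMatching (Dart G) (stAdj G)
    swapMatching = involution⇒perfectMatching _≟ᵈ_ swap swap-involutive stAdj-swap

    swap≢reverse : ¬ (∀ d → swap d ≡ reverse d)
    swap≢reverse same = adjacent⇒≢ (next-adjacent start-on) (cong origin (begin
      (start , prev start , prev-adjacent start-on) ≡⟨ swap-next start-on refl ⟨
      swap d₀                                       ≡⟨ same d₀ ⟩
      reverse d₀                                    ∎))
      where
      open ≡-Reasoning
      d₀ = start , next start , next-adjacent start-on

  orientedCycles⇒¬uniquePerfectMatching : OrientedCycles → ¬ HasUniquePerfectMatching (Dart G) (stAdj G)
  orientedCycles⇒¬uniquePerfectMatching C (_ , unique) =
    swap≢reverse C (M-≗⇒partner-≗ (swapMatching C) reversalMatching (unique (swapMatching C) reversalMatching))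

lemma3p4 : ∀ (n : ℕ) (G : SimpleGraph n) → Connected G → HasEdge G →
    HasPerfectMatching (Dart G) (stAdj G) ×
    (HasUniquePerfectMatching (Dart G) (stAdj G) ⇔ IsTree G)
lemma3p4 n G connected _ = reversalMatching G , mk⇔
  (λ unique → connected , λ cycle →
     orientedCycles⇒¬uniquePerfectMatching G (cycle⇒orientedCycles G cycle) unique)
  (λ (_ , acyclic) → acyclic⇒uniquePerfectMatching G acyclic)
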